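{- Let $G$ be a profinite subgroup of $S_\infty$ with orbit independence and let $\alpha$ be an existential sentence in the language of groups. Then $G\models\alpha$ if and only if $G_k\models\alpha$ for some $k\in\mathbb{N}$.
   Context: $S_\infty$ is the group of all permutations of $\mathbb{N}$, with the topology of pointwise convergence; its profinite subgroups are exactly the closed subgroups all of whose orbits $\mathrm{orb}_G(n)=\{g(n):g\in G\}$ are finite. The orbits of a profinite $G$ are enumerated as $O_{G,0}=\mathrm{orb}_G(0)$ and $O_{G,n+1}=$ the orbit of the least natural number not in any $O_{G,m}$, $m\le n$. For $g\in G$ and $k\in\mathbb{N}$, $g_k=g\restriction\bigcup_{i\le k}O_{G,i}$, and $G_k=\{g_k:g\in G\}$, a finite group under composition. $H_k=\{g\restriction O_{G,k}:g\in G\}$; $G$ has orbit independence if $G$ is isomorphic to $\prod_{k\in\mathbb{N}}H_k$. -}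

module Defs where

open import Level using (0ℓ)
open import Data.Nat using (ℕ; zero; suc; _<_)
open import Data.Fin using (Fin)
open import Data.List using (List)
open import Data.List.Membership.Propositional using (_∈_)
open import Data.Product using (Σ; _×_; _,_; proj₁)
open import Data.Sum using (_⊎_)
open import Relation.Nullary using (¬_)
open import Relation.Binary.PropositionalEquality using (_≡_)
open import Function.Bundles using (_↔_; Inverse)
open import Function.Construct.Composition using (_↔-∘_)
open import Function.Construct.Identity using (↔-id)
open import Function.Construct.Symmetry using (↔-sym)
open import Algebra.Bundles.Raw using (RawGroup)

Perm : Set
Perm = ℕ ↔ ℕ

ap : Perm → ℕ → ℕ
ap = Inverse.to

idP : Perm
idP = ↔-id ℕ

-- composition (g ∘ h)(n) = g (h n)
_∘P_ : Perm → Perm → Perm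
g ∘P h = g ↔-∘ h

invP : Perm → Perm
invP = ↔-sym

record IsSubgroup (G : Perm → Set) : Set where
  field
    id-closed  : G idP
    ∘-closed   : ∀ g h → G g → G h → G (g ∘P h)
    inv-closed : ∀ g → G g → G (invP g)

-- closed in the topology of pointwise convergence: every permutation in
-- the closure of G (i.e. every basic neighbourhood {h : h agrees with g
-- on {0,…,n-1}} meets G) belongs to G
IsClosed : (Perm → Set) → Set
IsClosed G = ∀ g → (∀ n → Σ Perm λ h → G h × (∀ m → m < n → ap h m ≡ ap g m)) → G g

orb : (Perm → Set) → ℕ → ℕ → Set
orb G n m = Σ Perm λ g → G g × ap g n ≡ m

FiniteOrbits : (Perm → Set) → Set
FiniteOrbits G = ∀ n → Σ (List ℕ) λ xs → ∀ m → orb G n m → m ∈ xs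

-- profinite subgroup of S_∞ = closed subgroup with all orbits finite
record Profinite (G : Perm → Set) : Set where
  field
    subgroup : IsSubgroup G
    closed   : IsClosed G
    finite   : FiniteOrbits G

-- Enumeration of orbits O_{G,k}
-- Rep G k r   : r is the representative of O_{G,k}
--               (r = 0 for k = 0, otherwise r = least natural number not in
--                any O_{G,i}, i < k)
-- Upto G k m  : m ∈ ⋃_{i ≤ k} O_{G,i}

mutual
  Rep : (Perm → Set) → ℕ → ℕ → Set
  Rep G zero r = r ≡ 0
  Rep G (suc k) r = ¬ Upto G k r × (∀ s → s < r → Upto G k s)

  Upto : (Perm → Set) → ℕ → ℕ → Set
  Upto G zero m = Σ ℕ λ r → Rep G zero r × orb G r m
  Upto G (suc k) m = Upto G k m ⊎ (Σ ℕ λ r → Rep G (suc k) r × orb G r m)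

InO : (Perm → Set) → ℕ → ℕ → Set
InO G k m = Σ ℕ λ r → Rep G k r × orb G r m

-- Orbit independence: the canonical homomorphism G → ∏_k H_k,
-- g ↦ (g ↾ O_{G,k})_k, is an isomorphism (bijective).  An element of
-- ∏_k H_k is given by a family (h_k)_k of elements of G, standing for
-- (h_k ↾ O_{G,k})_k.
record OrbitIndependent (G : Perm → Set) : Set where
  field
    injective  : ∀ g h → G g → G h →
                 (∀ k m → InO G k m → ap g m ≡ ap h m) → ∀ m → ap g m ≡ ap h m
    surjective : (h : ℕ → Perm) → (∀ k → G (h k)) →
                 Σ Perm λ g → G g × (∀ k m → InO G k m → ap g m ≡ ap (h k) m)

Elt : (Perm → Set) → Set
Elt G = Σ Perm G

GroupG : (G : Perm → Set) → IsSubgroup G → RawGroup 0ℓ 0ℓ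
GroupG G sg = record
  { Carrier = Elt G
  ; _≈_ = λ x y → ∀ m → ap (proj₁ x) m ≡ ap (proj₁ y) m
  ; _∙_ = λ { (g , p) (h , q) → (g ∘P h) , IsSubgroup.∘-closed sg g h p q }
  ; ε = idP , IsSubgroup.id-closed sg
  ; _⁻¹ = λ { (g , p) → invP g , IsSubgroup.inv-closed sg g p }
  }

-- G_k = { g ↾ ⋃_{i≤k} O_{G,i} : g ∈ G }: elements represented by g ∈ G,
-- two representatives being equal iff their restrictions coincide
GroupGk : (G : Perm → Set) → IsSubgroup G → ℕ → RawGroup 0ℓ 0ℓ
GroupGk G sg k = record
  { Carrier = Elt G
  ; _≈_ = λ x y → ∀ m → Upto G k m → ap (proj₁ x) m ≡ ap (proj₁ y) m
  ; _∙_ = λ { (g , p) (h , q) → (g ∘P h) , IsSubgroup.∘-closed sg g h p q }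
  ; ε = idP , IsSubgroup.id-closed sg
  ; _⁻¹ = λ { (g , p) → invP g , IsSubgroup.inv-closed sg g p }
  }

data Term (n : ℕ) : Set where
  var  : Fin n → Term n
  _·_  : Term n → Term n → Term n
  inv  : Term n → Term n
  e    : Term n

data QF (n : ℕ) : Set where
  _≐_  : Term n → Term n → QF n
  neg  : QF n → QF n
  _∧_  : QF n → QF n → QF n
  _∨_  : QF n → QF n → QF n

record ExSentence : Set where
  constructor ∃s
  field
    nvars  : ℕ
    matrix : QF nvars

module _ (M : RawGroup 0ℓ 0ℓ) where
  open RawGroup M

  evalT : ∀ {n} → (Fin n → Carrier) → Term n → Carrier
  evalT v (var i) = v i
  evalT v (s · t) = evalT v s ∙ evalT v t
  evalT v (inv t) = evalT v t ⁻¹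
  evalT v e = ε

  evalQF : ∀ {n} → (Fin n → Carrier) → QF n → Set
  evalQF v (s ≐ t) = evalT v s ≈ evalT v t
  evalQF v (neg φ) = ¬ evalQF v φ
  evalQF v (φ ∧ ψ) = evalQF v φ × evalQF v ψ
  evalQF v (φ ∨ ψ) = evalQF v φ ⊎ evalQF v ψ

  _⊨_ : ExSentence → Set
  _⊨_ (∃s n φ) = Σ (Fin n → Carrier) λ v → evalQF v φ

{-# OPTIONS --safe #-}
-- (⇒) An equation between terms fails in G only if it fails at some point m, and
-- m lies in the first m + 1 orbits; so for a fixed witness tuple every
-- quantifier-free formula has the same truth value in G as in G_k for all large k.
-- (⇐) Given witnesses in G_k, orbit independence replaces each of them by an element
-- of G acting like it on ⋃_{i≤k} O_{G,i} and trivially on all later orbits. Since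
-- ⋃_{i≤k} O_{G,i} is G-invariant, every term in the new witnesses acts there like the
-- same term in the old ones and trivially elsewhere, so an equation holds in G for the
-- new witnesses iff it holds in G_k for the old ones.
-- Excluded middle decides equations in G and shows that every number lies in some
-- orbit; of Profinite only the subgroup axioms are needed, and of orbit independence
-- only surjectivity.
module Submission where

open import Defs
open import Level using (0ℓ)
open import Data.Nat using (ℕ; zero; suc; _≤_; _<_; _≤′_; ≤′-refl; ≤′-step; z≤n; _⊔_; _≤?_)
open import Data.Nat.Properties
  using ( ≤-refl; ≤-pred; ≤⇒≤′; ≰⇒>; <⇒≱; m≤n⇒m≤1+n; m≤n⇒m<n∨m≡n
        ; m⊔n≤o⇒m≤o; m⊔n≤o⇒n≤o)
open import Data.Fin using (Fin)
open import Data.Product using (Σ; _×_; _,_; proj₁; proj₂)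
open import Data.Product.Function.NonDependent.Propositional using (_×-⇔_)
open import Data.Sum using (inj₁; inj₂)
open import Data.Sum.Function.Propositional using (_⊎-⇔_)
open import Function using (_∘_)
open import Function.Bundles using (Inverse; Equivalence; _⇔_; mk⇔)
open import Function.Construct.Composition using (_⇔-∘_)
open import Function.Construct.Identity using (⇔-id)
open import Function.Construct.Symmetry using (⇔-sym)
open import Function.Related.TypeIsomorphisms using (¬-cong-⇔)
open import Relation.Nullary using (¬_; yes; no; contradiction)
open import Relation.Binary.PropositionalEquality
  using (_≡_; refl; sym; trans; cong; module ≡-Reasoning)
open import Axiom.ExcludedMiddle using (ExcludedMiddle)
open import Axiom.DoubleNegationElimination using (em⇒dne)
open import Algebra.Bundles.Raw using (RawGroup)

Eventually : (ℕ → Set) → Set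
Eventually P = Σ ℕ λ K → ∀ k → K ≤ k → P k

eventually-map : {P Q : ℕ → Set} → (∀ {k} → P k → Q k) → Eventually P → Eventually Q
eventually-map f (K , p) = K , λ k K≤k → f (p k K≤k)

eventually-zipWith : {P Q R : ℕ → Set} → (∀ {k} → P k → Q k → R k) →
                     Eventually P → Eventually Q → Eventually R
eventually-zipWith f (K , p) (L , q) =
  K ⊔ L , λ k K⊔L≤k → f (p k (m⊔n≤o⇒m≤o K L K⊔L≤k)) (q k (m⊔n≤o⇒n≤o K L K⊔L≤k))

module _ (M : RawGroup 0ℓ 0ℓ) (N : ℕ → RawGroup 0ℓ 0ℓ) {n : ℕ}
         (v : Fin n → RawGroup.Carrier M) (w : (k : ℕ) → Fin n → RawGroup.Carrier (N k)) where

  evalQF-eventually-⇔ :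
    (∀ s t → Eventually (λ k → evalQF M v (s ≐ t) ⇔ evalQF (N k) (w k) (s ≐ t))) →
    ∀ φ → Eventually (λ k → evalQF M v φ ⇔ evalQF (N k) (w k) φ)
  evalQF-eventually-⇔ atoms (s ≐ t) = atoms s t
  evalQF-eventually-⇔ atoms (neg φ) = eventually-map ¬-cong-⇔ (evalQF-eventually-⇔ atoms φ)
  evalQF-eventually-⇔ atoms (φ ∧ ψ) =
    eventually-zipWith _×-⇔_ (evalQF-eventually-⇔ atoms φ) (evalQF-eventually-⇔ atoms ψ)
  evalQF-eventually-⇔ atoms (φ ∨ ψ) =
    eventually-zipWith _⊎-⇔_ (evalQF-eventually-⇔ atoms φ) (evalQF-eventually-⇔ atoms ψ)

module _ (M N : RawGroup 0ℓ 0ℓ) {n : ℕ}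
         (v : Fin n → RawGroup.Carrier M) (w : Fin n → RawGroup.Carrier N) where

  evalQF-⇔ : (∀ s t → evalQF M v (s ≐ t) ⇔ evalQF N w (s ≐ t)) →
             ∀ φ → evalQF M v φ ⇔ evalQF N w φ
  evalQF-⇔ atoms (s ≐ t) = atoms s t
  evalQF-⇔ atoms (neg φ) = ¬-cong-⇔ (evalQF-⇔ atoms φ)
  evalQF-⇔ atoms (φ ∧ ψ) = evalQF-⇔ atoms φ ×-⇔ evalQF-⇔ atoms ψ
  evalQF-⇔ atoms (φ ∨ ψ) = evalQF-⇔ atoms φ ⊎-⇔ evalQF-⇔ atoms ψ

AgreeOn : (ℕ → Set) → Perm → Perm → Set
AgreeOn S g h = ∀ m → S m → ap g m ≡ ap h m

invP-fixes : ∀ g {m} → ap g m ≡ m → ap (invP g) m ≡ m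
invP-fixes g {m} gm≡m = trans (cong (Inverse.from g) (sym gm≡m)) (Inverse.strictlyInverseʳ g m)

module _ {G : Perm → Set} where

  Upto-mono : ∀ {j k m} → j ≤ k → Upto G j m → Upto G k m
  Upto-mono j≤k = go (≤⇒≤′ j≤k)
    where
    go : ∀ {j k m} → j ≤′ k → Upto G j m → Upto G k m
    go ≤′-refl       u = u
    go (≤′-step j≤k) u = inj₁ (go j≤k u)

  InO⇒Upto : ∀ {j k m} → j ≤ k → InO G j m → Upto G k m
  InO⇒Upto {zero}  j≤k i = Upto-mono j≤k i
  InO⇒Upto {suc j} j≤k i = Upto-mono j≤k (inj₂ i)

  Upto⇒InO : ∀ {k m} → Upto G k m → Σ ℕ λ j → j ≤ k × InO G j m
  Upto⇒InO {zero}  i = 0 , z≤n , i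
  Upto⇒InO {suc k} (inj₁ u) with Upto⇒InO u
  ... | j , j≤k , i = j , m≤n⇒m≤1+n j≤k , i
  Upto⇒InO {suc k} (inj₂ i) = suc k , ≤-refl , i

module Subgroup {G : Perm → Set} (sg : IsSubgroup G) where
  open IsSubgroup sg

  orb-refl : ∀ r → orb G r r
  orb-refl r = idP , id-closed , refl

  InO-closed : ∀ {g j m} → G g → InO G j m → InO G j (ap g m)
  InO-closed {g} g∈G (r , rep , h , h∈G , hr≡m) =
    r , rep , g ∘P h , ∘-closed g h g∈G h∈G , cong (ap g) hr≡m

  Upto-closed : ∀ {g k m} → G g → Upto G k m → Upto G k (ap g m)
  Upto-closed g∈G u with Upto⇒InO u
  ... | j , j≤k , i = InO⇒Upto j≤k (InO-closed g∈G i)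

  evalPerm : ∀ {n} → (Fin n → Elt G) → Term n → Perm
  evalPerm v t = proj₁ (evalT (GroupG G sg) v t)

  evalPerm∈G : ∀ {n} (v : Fin n → Elt G) t → G (evalPerm v t)
  evalPerm∈G v t = proj₂ (evalT (GroupG G sg) v t)

  evalT-GroupGk : ∀ k {n} (v : Fin n → Elt G) t →
                  evalT (GroupGk G sg k) v t ≡ evalT (GroupG G sg) v t
  evalT-GroupGk k v (var i) = refl
  evalT-GroupGk k v (s · t) rewrite evalT-GroupGk k v s | evalT-GroupGk k v t = refl
  evalT-GroupGk k v (inv t) rewrite evalT-GroupGk k v t = refl
  evalT-GroupGk k v e       = refl

  ≐-GroupGk : ∀ k {n} (v : Fin n → Elt G) s t →
              evalQF (GroupGk G sg k) v (s ≐ t) ⇔ AgreeOn (Upto G k) (evalPerm v s) (evalPerm v t)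
  ≐-GroupGk k v s t rewrite evalT-GroupGk k v s | evalT-GroupGk k v t = ⇔-id _

  evalPerm-fixes : ∀ {n} (v : Fin n → Elt G) {m} → (∀ i → ap (proj₁ (v i)) m ≡ m) →
                   ∀ t → ap (evalPerm v t) m ≡ m
  evalPerm-fixes v fix (var i) = fix i
  evalPerm-fixes v fix (s · t) =
    trans (cong (ap (evalPerm v s)) (evalPerm-fixes v fix t)) (evalPerm-fixes v fix s)
  evalPerm-fixes v fix (inv t) = invP-fixes (evalPerm v t) (evalPerm-fixes v fix t)
  evalPerm-fixes v fix e       = refl

  module _ {S : ℕ → Set} (S-closed : ∀ {g m} → G g → S m → S (ap g m))
           {n} {v w : Fin n → Elt G} (v≈w : ∀ i → AgreeOn S (proj₁ (v i)) (proj₁ (w i))) where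

    evalPerm-agreeOn : ∀ t → AgreeOn S (evalPerm v t) (evalPerm w t)
    evalPerm-agreeOn (var i) = v≈w i
    evalPerm-agreeOn (s · t) m m∈S = begin
      ap (evalPerm v s) (ap (evalPerm v t) m) ≡⟨ cong (ap (evalPerm v s)) (evalPerm-agreeOn t m m∈S) ⟩
      ap (evalPerm v s) (ap (evalPerm w t) m) ≡⟨ evalPerm-agreeOn s _ (S-closed (evalPerm∈G w t) m∈S) ⟩
      ap (evalPerm w s) (ap (evalPerm w t) m) ∎
      where open ≡-Reasoning
    evalPerm-agreeOn (inv t) m m∈S = begin
      Inverse.from g m                ≡⟨ cong (Inverse.from g) (sym gx≡m) ⟩
      Inverse.from g (Inverse.to g x) ≡⟨ Inverse.strictlyInverseʳ g x ⟩
      x                               ∎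
      where
      open ≡-Reasoning
      g h : Perm
      g = evalPerm v t
      h = evalPerm w t
      x : ℕ
      x = Inverse.from h m
      gx≡m : Inverse.to g x ≡ m
      gx≡m = trans (evalPerm-agreeOn t x (S-closed (inv-closed h (evalPerm∈G w t)) m∈S))
                   (Inverse.strictlyInverseˡ h m)
    evalPerm-agreeOn e m m∈S = refl

  module _ (em : ExcludedMiddle 0ℓ) where

    ≤⇒Upto : ∀ {k m} → m ≤ k → Upto G k m
    ≤⇒Upto {zero} z≤n = 0 , refl , orb-refl 0
    ≤⇒Upto {suc k} m≤1+k with m≤n⇒m<n∨m≡n m≤1+k
    ... | inj₁ m<1+k = inj₁ (≤⇒Upto (≤-pred m<1+k))
    ... | inj₂ refl with em {Upto G k (suc k)}
    ...   | yes u  = inj₁ u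
    ...   | no ¬u = inj₂ (suc k , (¬u , λ m m<1+k → ≤⇒Upto (≤-pred m<1+k)) , orb-refl (suc k))

    InO-total : ∀ m → Σ ℕ λ j → InO G j m
    InO-total m with Upto⇒InO (≤⇒Upto {m} ≤-refl)
    ... | j , _ , i = j , i

    agreement-eventually : ∀ g h →
      Eventually (λ k → (∀ m → ap g m ≡ ap h m) ⇔ AgreeOn (Upto G k) g h)
    agreement-eventually g h with em {Σ ℕ λ m → ¬ ap g m ≡ ap h m}
    ... | yes (m , gm≢hm) =
      m , λ k m≤k → mk⇔ (λ g≗h → contradiction (g≗h m) gm≢hm)
                        (λ g≈h → contradiction (g≈h m (≤⇒Upto m≤k)) gm≢hm)
    ... | no ¬∃ = 0 , λ k _ → mk⇔ (λ g≗h m _ → g≗h m) (λ _ → g≗h)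
      where
      g≗h : ∀ m → ap g m ≡ ap h m
      g≗h m = em⇒dne em (λ gm≢hm → ¬∃ (m , gm≢hm))

    evalQF-GroupGk-eventually : ∀ {n} (v : Fin n → Elt G) φ →
      Eventually (λ k → evalQF (GroupG G sg) v φ ⇔ evalQF (GroupGk G sg k) v φ)
    evalQF-GroupGk-eventually v = evalQF-eventually-⇔ (GroupG G sg) (GroupGk G sg) v (λ _ → v) atoms
      where
      atoms : ∀ s t → Eventually (λ k →
                evalQF (GroupG G sg) v (s ≐ t) ⇔ evalQF (GroupGk G sg k) v (s ≐ t))
      atoms s t = eventually-map (λ {k} agree → ⇔-sym (≐-GroupGk k v s t) ⇔-∘ agree)
                                 (agreement-eventually (evalPerm v s) (evalPerm v t))

    ⊨-GroupG⇒⊨-GroupGk : ∀ α → _⊨_ (GroupG G sg) α → Σ ℕ λ k → _⊨_ (GroupGk G sg k) α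
    ⊨-GroupG⇒⊨-GroupGk (∃s n φ) (v , v⊨φ) with evalQF-GroupGk-eventually v φ
    ... | K , agree = K , v , Equivalence.to (agree K ≤-refl) v⊨φ

    module Truncation (oi : OrbitIndependent G) (k : ℕ) where

      cutoff : Elt G → ℕ → Elt G
      cutoff x j with j ≤? k
      ... | yes _ = x
      ... | no _  = idP , id-closed

      private
        lift : ∀ x → Σ Perm λ g → G g × (∀ j m → InO G j m → ap g m ≡ ap (proj₁ (cutoff x j)) m)
        lift x = OrbitIndependent.surjective oi (proj₁ ∘ cutoff x) (proj₂ ∘ cutoff x)

      truncate : Elt G → Elt G
      truncate x = proj₁ (lift x) , proj₁ (proj₂ (lift x))

      truncate-cutoff : ∀ x {j m} → InO G j m →
                        ap (proj₁ (truncate x)) m ≡ ap (proj₁ (cutoff x j)) m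
      truncate-cutoff x {j} {m} = proj₂ (proj₂ (lift x)) j m

      truncate-agreeOn : ∀ x → AgreeOn (Upto G k) (proj₁ (truncate x)) (proj₁ x)
      truncate-agreeOn x m u with Upto⇒InO u
      ... | j , j≤k , i with j ≤? k | truncate-cutoff x i
      ...   | yes _  | eq = eq
      ...   | no j≰k | _  = contradiction j≤k j≰k

      truncate-fixes : ∀ x {j m} → k < j → InO G j m → ap (proj₁ (truncate x)) m ≡ m
      truncate-fixes x {j} k<j i with j ≤? k | truncate-cutoff x i
      ... | yes j≤k | _  = contradiction j≤k (<⇒≱ k<j)
      ... | no _    | eq = eq

      ≐-truncate : ∀ {n} (v : Fin n → Elt G) s t →
                   evalQF (GroupG G sg) (truncate ∘ v) (s ≐ t) ⇔
                   AgreeOn (Upto G k) (evalPerm v s) (evalPerm v t)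
      ≐-truncate v s t = mk⇔ restrict extend
        where
        v′ : Fin _ → Elt G
        v′ = truncate ∘ v

        agree : ∀ t → AgreeOn (Upto G k) (evalPerm v′ t) (evalPerm v t)
        agree = evalPerm-agreeOn Upto-closed (truncate-agreeOn ∘ v)

        restrict : (∀ m → ap (evalPerm v′ s) m ≡ ap (evalPerm v′ t) m) →
                   AgreeOn (Upto G k) (evalPerm v s) (evalPerm v t)
        restrict s′≗t′ m u = trans (sym (agree s m u)) (trans (s′≗t′ m) (agree t m u))

        extend : AgreeOn (Upto G k) (evalPerm v s) (evalPerm v t) →
                 ∀ m → ap (evalPerm v′ s) m ≡ ap (evalPerm v′ t) m
        extend s≈t m with InO-total m
        ... | j , i with j ≤? k
        ...   | yes j≤k = trans (agree s m u) (trans (s≈t m u) (sym (agree t m u)))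
          where u = InO⇒Upto j≤k i
        ...   | no j≰k  = trans (fixes s) (sym (fixes t))
          where fixes = evalPerm-fixes v′ (λ l → truncate-fixes (v l) (≰⇒> j≰k) i)

      evalQF-truncate : ∀ {n} (v : Fin n → Elt G) φ →
                        evalQF (GroupG G sg) (truncate ∘ v) φ ⇔ evalQF (GroupGk G sg k) v φ
      evalQF-truncate v = evalQF-⇔ (GroupG G sg) (GroupGk G sg k) (truncate ∘ v) v
                                   (λ s t → ⇔-sym (≐-GroupGk k v s t) ⇔-∘ ≐-truncate v s t)

    ⊨-GroupGk⇒⊨-GroupG : OrbitIndependent G →
                         ∀ α → (Σ ℕ λ k → _⊨_ (GroupGk G sg k) α) → _⊨_ (GroupG G sg) α
    ⊨-GroupGk⇒⊨-GroupG oi (∃s n φ) (k , v , v⊨φ) =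
      truncate ∘ v , Equivalence.from (evalQF-truncate v φ) v⊨φ
      where open Truncation oi k

lemma4 : ExcludedMiddle 0ℓ → (G : Perm → Set) → (pf : Profinite G) → OrbitIndependent G →
         (α : ExSentence) →
         (_⊨_ (GroupG G (Profinite.subgroup pf)) α →
            Σ ℕ λ k → _⊨_ (GroupGk G (Profinite.subgroup pf) k) α)
         × ((Σ ℕ λ k → _⊨_ (GroupGk G (Profinite.subgroup pf) k) α) →
            _⊨_ (GroupG G (Profinite.subgroup pf)) α)
lemma4 em G pf oi α = ⊨-GroupG⇒⊨-GroupGk em α , ⊨-GroupGk⇒⊨-GroupG em oi α
  where open Subgroup (Profinite.subgroup pf)
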